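{- Let $R$ be a commutative ring, let $r<s$ be positive integers of opposite parity, and let $A,B,D\in R$. Define $(h_m)_{m\in\mathbb{Z}}$ by $h_m=-AB^{k(k+1)/2}D^{k(k-1)/2}$ if $m=k(r+s)-r$ with $k\in\mathbb{Z}$; $h_m=AB^{k(k-1)/2}D^{k(k+1)/2}$ if $m=k(r+s)+r$ with $k\in\mathbb{Z}$; and $h_m=0$ if $m\not\equiv\pm r\pmod{r+s}$. (This sequence is denoted $A\cdot\operatorname{ES}_{r,s}(B,D)$.) Then $h$ is elliptic: for all $a,b,c,d\in\mathbb{Z}$, $$h_{a+b}h_{a-b}h_{c+d}h_{c-d}=h_{a+c}h_{a-c}h_{b+d}h_{b-d}-h_{b+c}h_{b-c}h_{a+d}h_{a-d}.$$ -}

module Defs where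

open import Level using (Level)
open import Data.Nat as ℕ using (ℕ; zero; suc)
open import Data.Integer as ℤ using (ℤ; +_; -[1+_]; _/ℕ_; _%ℕ_)
open import Algebra.Bundles using (CommutativeRing)
import Algebra.Bundles
import Algebra.Definitions.RawSemiring as RS
import Relation.Nullary

-- tri k = k(k+1)/2 for k ∈ ℤ, which is always a natural number:
--   k = n ≥ 0      : n(n+1)/2
--   k = -(n+1) < 0 : (-(n+1))(-n)/2 = n(n+1)/2
tri : ℤ → ℕ
tri (+ n)      = (n ℕ.* suc n) ℕ./ 2
tri -[1+ n ]   = (n ℕ.* suc n) ℕ./ 2

tri⁻ : ℤ → ℕ
tri⁻ k = tri (k ℤ.- ℤ.1ℤ)

module _ {c ℓ : Level} (R : CommutativeRing c ℓ) where
  open CommutativeRing R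
  open RS (Algebra.Bundles.Semiring.rawSemiring semiring) using (_^_)

  -- Write m = q·n + ρ with 0 ≤ ρ < n (floor division), n = r + s.
  --  * ρ = r  : m = k(r+s) + r with k = q,      h_m =  A B^{k(k-1)/2} D^{k(k+1)/2}
  --  * ρ = s  : m = k(r+s) - r with k = q + 1,  h_m = -A B^{k(k+1)/2} D^{k(k-1)/2}
  --  * else   : m ≢ ±r (mod r+s),                h_m = 0
  -- (For r < s the residues r and s are distinct, so the cases are disjoint.)
  ES-aux : (r s n : ℕ) → .{{ℕ.NonZero n}} → (A B D : Carrier) → ℤ → Carrier
  ES-aux r s n A B D m with (m %ℕ n) ℕ.≟ r | (m %ℕ n) ℕ.≟ s
  ... | Relation.Nullary.yes _ | _ =
        let k = m /ℕ n in A * (B ^ tri⁻ k) * (D ^ tri k)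
  ... | Relation.Nullary.no _ | Relation.Nullary.yes _ =
        let k = (m /ℕ n) ℤ.+ ℤ.1ℤ in - (A * (B ^ tri k) * (D ^ tri⁻ k))
  ... | Relation.Nullary.no _ | Relation.Nullary.no _ = 0#

  -- The sequence A · ES_{r,s}(B,D), indexed by ℤ.
  -- (If r + s = 0 the sequence is irrelevant; we set it to 0.)
  ES : (r s : ℕ) (A B D : Carrier) → ℤ → Carrier
  ES r s A B D m with r ℕ.+ s
  ... | zero  = 0#
  ... | suc n = ES-aux r s (suc n) A B D m

{-# OPTIONS --safe #-}
module Submission where

-- Write N = r + s (odd) and P(x, y) = h(x + y) h(x - y).  The sequence h is supported on
-- ±r + Nℤ; since 2 is invertible modulo N, P(x, y) ≠ 0 forces x and y into Nℤ ∪ (±r + Nℤ),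
-- and P vanishes unless exactly one of them lies in Nℤ.  The triangular numbers
-- T(k) = k(k+1)/2 satisfy the parallelogram law T(l + j) + T(l - j) = j² + 2 T(l), so
-- e(k) = A B^(k(k-1)/2) D^(k(k+1)/2) satisfies e(l + j) e(l - j) = e(l)² (BD)^(j²).
-- Hence P(x, y) = det(v x, v y) for the axis vectors v(jN) = (0, (BD)^(j²)),
-- v(±(lN + r)) = (e(l)², 0) and v x = 0 otherwise, and the elliptic relation is the
-- Plücker relation [ab][cd] = [ac][bd] - [bc][ad] between 2 × 2 determinants.

open import Defs
open import Level using (Level)
open import Data.Nat as ℕ using (ℕ; zero; suc; _<_; _%_; NonZero; s≤s)
open import Data.Integer as ℤ using (ℤ; +_; -[1+_]; +0; +[1+_]; 1ℤ; _/ℕ_; _%ℕ_)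
open import Relation.Binary.PropositionalEquality
  using (_≡_; _≢_; refl; sym; trans; cong; cong₂; subst; module ≡-Reasoning)
open import Algebra.Bundles using (CommutativeRing)

import Data.Nat.Properties as ℕ
import Data.Nat.Divisibility as ℕ
open import Data.Nat.DivMod using (m/n*n≡m; %-distribˡ-+; m%n<n; m≡m%n+[m/n]*n)
import Data.Nat.Tactic.RingSolver as ℕ-Solver
import Data.Integer.Properties as ℤ
open import Data.Integer.DivMod using (a≡a%ℕn+[a/ℕn]*n; n%ℕd<d)
open import Data.Integer.Divisibility.Signed
  using (_∣_; divides; _∣?_; ∣-refl; ∣m∣n⇒∣m+n; ∣m∣n⇒∣m-n; ∣m+n∣m⇒∣n; ∣m⇒∣-m; ∣n⇒∣m*n; ∣⇒∣ᵤ)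
open import Data.Integer.Tactic.RingSolver using (solve; solve-∀)
open import Data.List using (_∷_; [])
open import Data.Product using (_×_; _,_; proj₁; proj₂)
open import Data.Sum using (_⊎_; inj₁; inj₂; [_,_]′)
open import Data.Empty using (⊥-elim)
open import Function using (_∘_)
open import Relation.Nullary using (¬_; Dec; yes; no; contradiction)
open import Relation.Nullary.Decidable using (_⊎-dec_)
open import Algebra.Properties.AbelianGroup ℤ.+-0-abelianGroup using (∙-cancelˡ)
import Algebra.Properties.Ring as RingProperties
import Algebra.Properties.CommutativeSemigroup as CommutativeSemigroupProperties
import Algebra.Properties.CommutativeSemiring.Exp as CommutativeSemiringExp
import Algebra.Solver.CommutativeMonoid as CommutativeMonoidSolver

[m+n]%2≡1 : ∀ m n → m % 2 ≢ n % 2 → (m ℕ.+ n) % 2 ≡ 1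
[m+n]%2≡1 m n m≢n = trans (%-distribˡ-+ m n 2) (distinct-bits (m%n<n m 2) (m%n<n n 2) m≢n)
  where
  distinct-bits : ∀ {a b} → a < 2 → b < 2 → a ≢ b → (a ℕ.+ b) % 2 ≡ 1
  distinct-bits {0} {0} _ _ a≢b = contradiction refl a≢b
  distinct-bits {0} {1} _ _ _   = refl
  distinct-bits {1} {0} _ _ _   = refl
  distinct-bits {1} {1} _ _ a≢b = contradiction refl a≢b
  distinct-bits {suc (suc _)} (s≤s (s≤s ())) _ _
  distinct-bits {_} {suc (suc _)} _ (s≤s (s≤s ())) _

odd-sum : ∀ m n → m % 2 ≢ n % 2 → m ℕ.+ n ≡ suc ((m ℕ.+ n) ℕ./ 2 ℕ.* 2)
odd-sum m n m≢n =
  trans (m≡m%n+[m/n]*n (m ℕ.+ n) 2) (cong (ℕ._+ (m ℕ.+ n) ℕ./ 2 ℕ.* 2) ([m+n]%2≡1 m n m≢n))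

∣m*2⇒∣m : ∀ {n m} t → n ≡ t ℤ.* + 2 ℤ.+ 1ℤ → n ∣ m ℤ.* + 2 → n ∣ m
∣m*2⇒∣m {m = m} t refl n∣2m =
  subst (_ ∣_) (odd-combination m t) (∣m∣n⇒∣m-n (∣n⇒∣m*n m ∣-refl) (∣n⇒∣m*n t n∣2m))
  where
  odd-combination : ∀ m t → m ℤ.* (t ℤ.* + 2 ℤ.+ 1ℤ) ℤ.- t ℤ.* (m ℤ.* + 2) ≡ m
  odd-combination = solve-∀

private
  quotient-≤ : ∀ {n} q q′ {ρ ρ′} → ρ < n → q ℤ.* + n ℤ.+ + ρ ≡ q′ ℤ.* + n ℤ.+ + ρ′ → q′ ℤ.≤ q
  quotient-≤ {n} q q′ {ρ} {ρ′} ρ<n eq = ℤ.≮⇒≥ λ q<q′ → ℤ.<-irrefl refl (begin-strict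
    q ℤ.* + n ℤ.+ + n      ≡⟨ trans (ℤ.+-comm (q ℤ.* + n) (+ n)) (sym (ℤ.suc-* q (+ n))) ⟩
    ℤ.suc q ℤ.* + n        ≤⟨ ℤ.*-monoʳ-≤-nonNeg (+ n) (ℤ.i<j⇒suc[i]≤j q<q′) ⟩
    q′ ℤ.* + n             ≤⟨ ℤ.i≤i+j (q′ ℤ.* + n) (+ ρ′) ⟩
    q′ ℤ.* + n ℤ.+ + ρ′    ≡⟨ eq ⟨
    q ℤ.* + n ℤ.+ + ρ      <⟨ ℤ.+-monoʳ-< (q ℤ.* + n) (ℤ.+<+ ρ<n) ⟩
    q ℤ.* + n ℤ.+ + n      ∎)
    where open ℤ.≤-Reasoning

divmod-unique : ∀ {n} .{{_ : NonZero n}} q {ρ} → ρ < n →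
                (q ℤ.* + n ℤ.+ + ρ) /ℕ n ≡ q × (q ℤ.* + n ℤ.+ + ρ) %ℕ n ≡ ρ
divmod-unique {n} q {ρ} ρ<n = quotient≡q , ℤ.+-injective (∙-cancelˡ (q ℤ.* + n) _ _ remainders)
  where
  x = q ℤ.* + n ℤ.+ + ρ
  decomposition : (x /ℕ n) ℤ.* + n ℤ.+ + (x %ℕ n) ≡ x
  decomposition = trans (ℤ.+-comm ((x /ℕ n) ℤ.* + n) (+ (x %ℕ n))) (sym (a≡a%ℕn+[a/ℕn]*n x n))
  quotient≡q : x /ℕ n ≡ q
  quotient≡q = ℤ.≤-antisym (quotient-≤ q (x /ℕ n) ρ<n (sym decomposition))
                           (quotient-≤ (x /ℕ n) q (n%ℕd<d x n) decomposition)
  remainders : q ℤ.* + n ℤ.+ + (x %ℕ n) ≡ q ℤ.* + n ℤ.+ + ρ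
  remainders = trans (cong (λ k → k ℤ.* + n ℤ.+ + (x %ℕ n)) (sym quotient≡q)) decomposition

2∣n*[1+n] : ∀ n → 2 ℕ.∣ n ℕ.* suc n
2∣n*[1+n] zero    = 2 ℕ.∣0
2∣n*[1+n] (suc n) = subst (2 ℕ.∣_) (expand n) (ℕ.∣m∣n⇒∣m+n (2∣n*[1+n] n) (ℕ.m∣m*n (suc n)))
  where
  expand : ∀ n → n ℕ.* suc n ℕ.+ 2 ℕ.* suc n ≡ suc n ℕ.* suc (suc n)
  expand = ℕ-Solver.solve-∀

tri-double : ∀ k → + tri k ℤ.* + 2 ≡ k ℤ.* (1ℤ ℤ.+ k)
tri-double (+ n) = begin
  + ((n ℕ.* suc n) ℕ./ 2) ℤ.* + 2   ≡⟨ ℤ.pos-* ((n ℕ.* suc n) ℕ./ 2) 2 ⟨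
  + ((n ℕ.* suc n) ℕ./ 2 ℕ.* 2)      ≡⟨ cong +_ (m/n*n≡m (2∣n*[1+n] n)) ⟩
  + (n ℕ.* suc n)                    ≡⟨ ℤ.pos-* n (suc n) ⟩
  + n ℤ.* (1ℤ ℤ.+ + n)               ∎
  where open ≡-Reasoning
tri-double -[1+ n ] = trans (tri-double (+ n)) (reflect (+ n))
  where
  reflect : ∀ i → i ℤ.* (1ℤ ℤ.+ i) ≡ ℤ.- (1ℤ ℤ.+ i) ℤ.* (1ℤ ℤ.+ ℤ.- (1ℤ ℤ.+ i))
  reflect = solve-∀

tri-neg : ∀ k → tri (ℤ.- k) ≡ tri⁻ k
tri-neg +0       = refl
tri-neg +[1+ n ] = refl
tri-neg -[1+ n ] rewrite ℕ.+-identityʳ n = refl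

tri⁻-neg : ∀ k → tri⁻ (ℤ.- k) ≡ tri k
tri⁻-neg k = trans (sym (tri-neg (ℤ.- k))) (cong tri (ℤ.neg-involutive k))

∣i∣*∣i∣≡i*i : ∀ i → + (ℤ.∣ i ∣ ℕ.* ℤ.∣ i ∣) ≡ i ℤ.* i
∣i∣*∣i∣≡i*i (+ n)    = ℤ.pos-* n n
∣i∣*∣i∣≡i*i -[1+ n ] = refl

tri-parallelogram : ∀ k j →
  tri (k ℤ.+ j) ℕ.+ tri (k ℤ.- j) ≡ ℤ.∣ j ∣ ℕ.* ℤ.∣ j ∣ ℕ.+ (tri k ℕ.+ tri k)
tri-parallelogram k j = ℤ.+-injective (ℤ.*-cancelʳ-≡ _ _ (+ 2) (begin
  (+ tri (k ℤ.+ j) ℤ.+ + tri (k ℤ.- j)) ℤ.* + 2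
    ≡⟨ ℤ.*-distribʳ-+ (+ 2) (+ tri (k ℤ.+ j)) (+ tri (k ℤ.- j)) ⟩
  + tri (k ℤ.+ j) ℤ.* + 2 ℤ.+ + tri (k ℤ.- j) ℤ.* + 2
    ≡⟨ cong₂ ℤ._+_ (tri-double (k ℤ.+ j)) (tri-double (k ℤ.- j)) ⟩
  (k ℤ.+ j) ℤ.* (1ℤ ℤ.+ (k ℤ.+ j)) ℤ.+ (k ℤ.- j) ℤ.* (1ℤ ℤ.+ (k ℤ.- j))
    ≡⟨ solve (k ∷ j ∷ []) ⟩
  j ℤ.* j ℤ.* + 2 ℤ.+ (k ℤ.* (1ℤ ℤ.+ k) ℤ.+ k ℤ.* (1ℤ ℤ.+ k))
    ≡⟨ cong₂ (λ a b → a ℤ.* + 2 ℤ.+ (b ℤ.+ b)) (∣i∣*∣i∣≡i*i j) (tri-double k) ⟨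
  + (ℤ.∣ j ∣ ℕ.* ℤ.∣ j ∣) ℤ.* + 2 ℤ.+ (+ tri k ℤ.* + 2 ℤ.+ + tri k ℤ.* + 2)
    ≡⟨ distrib (+ (ℤ.∣ j ∣ ℕ.* ℤ.∣ j ∣)) (+ tri k) ⟩
  (+ (ℤ.∣ j ∣ ℕ.* ℤ.∣ j ∣) ℤ.+ (+ tri k ℤ.+ + tri k)) ℤ.* + 2 ∎))
  where
  open ≡-Reasoning
  distrib : ∀ a b → a ℤ.* + 2 ℤ.+ (b ℤ.* + 2 ℤ.+ b ℤ.* + 2) ≡ (a ℤ.+ (b ℤ.+ b)) ℤ.* + 2
  distrib = solve-∀

tri⁻-parallelogram : ∀ k j →
  tri⁻ (k ℤ.+ j) ℕ.+ tri⁻ (k ℤ.- j) ≡ ℤ.∣ j ∣ ℕ.* ℤ.∣ j ∣ ℕ.+ (tri⁻ k ℕ.+ tri⁻ k)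
tri⁻-parallelogram k j = begin
  tri (k ℤ.+ j ℤ.- 1ℤ) ℕ.+ tri (k ℤ.- j ℤ.- 1ℤ)
    ≡⟨ cong₂ (λ a b → tri a ℕ.+ tri b) (+-shift k j) (−-shift k j) ⟩
  tri (k ℤ.- 1ℤ ℤ.+ j) ℕ.+ tri (k ℤ.- 1ℤ ℤ.- j)
    ≡⟨ tri-parallelogram (k ℤ.- 1ℤ) j ⟩
  ℤ.∣ j ∣ ℕ.* ℤ.∣ j ∣ ℕ.+ (tri⁻ k ℕ.+ tri⁻ k) ∎
  where
  open ≡-Reasoning
  +-shift : ∀ k j → k ℤ.+ j ℤ.- 1ℤ ≡ k ℤ.- 1ℤ ℤ.+ j
  +-shift = solve-∀
  −-shift : ∀ k j → k ℤ.- j ℤ.- 1ℤ ≡ k ℤ.- 1ℤ ℤ.- j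
  −-shift = solve-∀

module Residues (N ρ : ℤ) where

  Support : ℤ → Set
  Support m = N ∣ m ℤ.- ρ ⊎ N ∣ m ℤ.+ ρ

  Support₀ : ℤ → Set
  Support₀ m = N ∣ m ⊎ Support m

  support? : ∀ m → Dec (Support m)
  support? m = N ∣? m ℤ.- ρ ⊎-dec N ∣? m ℤ.+ ρ

  data Residue (x : ℤ) : Set where
    multiple : ∀ j → x ≡ j ℤ.* N → Residue x
    plus     : ∀ l → x ≡ l ℤ.* N ℤ.+ ρ → Residue x
    minus    : ∀ l → x ≡ ℤ.- (l ℤ.* N ℤ.+ ρ) → Residue x
    other    : ¬ Support₀ x → Residue x

  residue : ∀ x → Residue x
  residue x with N ∣? x | N ∣? x ℤ.- ρ | N ∣? x ℤ.+ ρ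
  ... | yes (divides j x≡jN) | _ | _ = multiple j x≡jN
  ... | no _ | yes (divides l x-ρ≡lN) | _ = plus l (begin
    x                   ≡⟨ solve (x ∷ ρ ∷ []) ⟩
    x ℤ.- ρ ℤ.+ ρ       ≡⟨ cong (ℤ._+ ρ) x-ρ≡lN ⟩
    l ℤ.* N ℤ.+ ρ       ∎)
    where open ≡-Reasoning
  ... | no _ | no _ | yes (divides l x+ρ≡lN) = minus (ℤ.- l) (begin
    x                           ≡⟨ solve (x ∷ ρ ∷ []) ⟩
    ℤ.- (ℤ.- (x ℤ.+ ρ) ℤ.+ ρ)  ≡⟨ cong (λ a → ℤ.- (ℤ.- a ℤ.+ ρ)) x+ρ≡lN ⟩
    ℤ.- (ℤ.- (l ℤ.* N) ℤ.+ ρ)  ≡⟨ cong (λ a → ℤ.- (a ℤ.+ ρ)) (ℤ.neg-distribˡ-* l N) ⟩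
    ℤ.- (ℤ.- l ℤ.* N ℤ.+ ρ)    ∎)
    where open ≡-Reasoning
  ... | no ∤x | no ∤x-ρ | no ∤x+ρ = other [ ∤x , [ ∤x-ρ , ∤x+ρ ]′ ]′

  ∣plus-plus : ∀ l k → N ∣ (l ℤ.* N ℤ.+ ρ) ℤ.- (k ℤ.* N ℤ.+ ρ)
  ∣plus-plus l k = divides (l ℤ.- k) (solve (l ∷ k ∷ N ∷ ρ ∷ []))

  ∣plus+minus : ∀ l k → N ∣ (l ℤ.* N ℤ.+ ρ) ℤ.+ ℤ.- (k ℤ.* N ℤ.+ ρ)
  ∣plus+minus l k = divides (l ℤ.- k) (solve (l ∷ k ∷ N ∷ ρ ∷ []))

  ∣minus+plus : ∀ l k → N ∣ ℤ.- (l ℤ.* N ℤ.+ ρ) ℤ.+ (k ℤ.* N ℤ.+ ρ)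
  ∣minus+plus l k = divides (k ℤ.- l) (solve (l ∷ k ∷ N ∷ ρ ∷ []))

  ∣minus-minus : ∀ l k → N ∣ ℤ.- (l ℤ.* N ℤ.+ ρ) ℤ.- ℤ.- (k ℤ.* N ℤ.+ ρ)
  ∣minus-minus l k = divides (k ℤ.- l) (solve (l ∷ k ∷ N ∷ ρ ∷ []))

  support-halves : ∀ {x y} t → N ≡ t ℤ.* + 2 ℤ.+ 1ℤ →
                   Support (x ℤ.+ y) → Support (x ℤ.- y) → Support₀ x × Support₀ y
  support-halves {x} {y} t N≡2t+1 = halves
    where
    halve : ∀ {a z} → N ∣ a → a ≡ z ℤ.* + 2 → N ∣ z
    halve N∣a refl = ∣m*2⇒∣m t N≡2t+1 N∣a

    halves : Support (x ℤ.+ y) → Support (x ℤ.- y) → Support₀ x × Support₀ y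
    halves (inj₁ d₁) (inj₁ d₂) =
      inj₂ (inj₁ (halve (∣m∣n⇒∣m+n d₁ d₂) (solve (x ∷ y ∷ ρ ∷ [])))) ,
      inj₁ (halve (∣m∣n⇒∣m-n d₁ d₂) (solve (x ∷ y ∷ ρ ∷ [])))
    halves (inj₁ d₁) (inj₂ d₂) =
      inj₁ (halve (∣m∣n⇒∣m+n d₁ d₂) (solve (x ∷ y ∷ ρ ∷ []))) ,
      inj₂ (inj₁ (halve (∣m∣n⇒∣m-n d₁ d₂) (solve (x ∷ y ∷ ρ ∷ []))))
    halves (inj₂ d₁) (inj₁ d₂) =
      inj₁ (halve (∣m∣n⇒∣m+n d₁ d₂) (solve (x ∷ y ∷ ρ ∷ []))) ,
      inj₂ (inj₂ (halve (∣m∣n⇒∣m-n d₁ d₂) (solve (x ∷ y ∷ ρ ∷ []))))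
    halves (inj₂ d₁) (inj₂ d₂) =
      inj₂ (inj₂ (halve (∣m∣n⇒∣m+n d₁ d₂) (solve (x ∷ y ∷ ρ ∷ [])))) ,
      inj₁ (halve (∣m∣n⇒∣m-n d₁ d₂) (solve (x ∷ y ∷ ρ ∷ [])))

module _ {c ℓ : Level} (R : CommutativeRing c ℓ) where

  open CommutativeRing R
    renaming (refl to ≈-refl; sym to ≈-sym; trans to ≈-trans; reflexive to ≈-reflexive)
  open RingProperties ring
    using (-‿distribˡ-*; -‿distribʳ-*; -‿involutive; -0#≈0#; x≈y⇒x∙y⁻¹≈ε)
  open CommutativeSemigroupProperties *-commutativeSemigroup using (interchange)
  open import Relation.Binary.Reasoning.Setoid setoid

  -x*-y≈x*y : ∀ x y → - x * - y ≈ x * y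
  -x*-y≈x*y x y = begin
    - x * - y     ≈⟨ -‿distribˡ-* x (- y) ⟨
    - (x * - y)   ≈⟨ -‿cong (-‿distribʳ-* x y) ⟨
    - - (x * y)   ≈⟨ -‿involutive (x * y) ⟩
    x * y         ∎

  -- The vectors (a, 0) and (0, b) of R²: every vector the proof needs lies on an axis, and
  -- for such vectors the Plücker relation is a finite case check.
  infix 10 ⟨_,0⟩ ⟨0,_⟩

  data AxisVector : Set c where
    ⟨_,0⟩ ⟨0,_⟩ : Carrier → AxisVector

  det : AxisVector → AxisVector → Carrier
  det ⟨ a ,0⟩ ⟨0, b ⟩ = a * b
  det ⟨0, b ⟩ ⟨ a ,0⟩ = - (a * b)
  det _       _       = 0#

  det-zeroˡ : ∀ v → det ⟨ 0# ,0⟩ v ≈ 0#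
  det-zeroˡ ⟨ _ ,0⟩ = ≈-refl
  det-zeroˡ ⟨0, b ⟩ = zeroˡ b

  det-zeroʳ : ∀ u → det u ⟨ 0# ,0⟩ ≈ 0#
  det-zeroʳ ⟨ _ ,0⟩ = ≈-refl
  det-zeroʳ ⟨0, b ⟩ = ≈-trans (-‿cong (zeroˡ b)) -0#≈0#

  private
    swap-first : ∀ a b c d → (a * b) * (c * d) ≈ (c * b) * (a * d)
    swap-first a b c d = begin
      (a * b) * (c * d) ≈⟨ interchange a b c d ⟩
      (a * c) * (b * d) ≈⟨ *-congʳ (*-comm a c) ⟩
      (c * a) * (b * d) ≈⟨ interchange c b a d ⟨
      (c * b) * (a * d) ∎

    swap-second : ∀ a b c d → (a * b) * (c * d) ≈ (a * d) * (c * b)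
    swap-second a b c d = ≈-trans (*-comm _ _) (swap-first c d a b)

    all-vanish : ∀ {p q s} → p ≈ 0# → q ≈ 0# → s ≈ 0# → p ≈ q - s
    all-vanish {p} {q} {s} p≈0 q≈0 s≈0 = begin
      p        ≈⟨ p≈0 ⟩
      0#       ≈⟨ -0#≈0# ⟨
      - 0#     ≈⟨ +-identityˡ (- 0#) ⟨
      0# - 0#  ≈⟨ +-cong q≈0 (-‿cong s≈0) ⟨
      q - s    ∎

    left-vanishes : ∀ {q s} → q ≈ s → 0# * 0# ≈ q - s
    left-vanishes q≈s = ≈-trans (zeroˡ 0#) (≈-sym (x≈y⇒x∙y⁻¹≈ε q≈s))

    middle-vanishes : ∀ {p s} → p ≈ - s → p ≈ 0# * 0# - s
    middle-vanishes {p} {s} p≈-s = begin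
      p             ≈⟨ p≈-s ⟩
      - s           ≈⟨ +-identityˡ (- s) ⟨
      0# - s        ≈⟨ +-congʳ (zeroˡ 0#) ⟨
      0# * 0# - s   ∎

    right-vanishes : ∀ {p q} → p ≈ q → p ≈ q - 0# * 0#
    right-vanishes {p} {q} p≈q = begin
      p              ≈⟨ p≈q ⟩
      q              ≈⟨ +-identityʳ q ⟨
      q + 0#         ≈⟨ +-congˡ -0#≈0# ⟨
      q - 0#         ≈⟨ +-congˡ (-‿cong (zeroˡ 0#)) ⟨
      q - 0# * 0#    ∎

  plücker : ∀ u v w x → det u v * det w x ≈ det u w * det v x - det v w * det u x
  plücker ⟨ a ,0⟩ ⟨ b ,0⟩ ⟨ c ,0⟩ ⟨ d ,0⟩ = all-vanish (zeroˡ _) (zeroˡ _) (zeroˡ _)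
  plücker ⟨ a ,0⟩ ⟨ b ,0⟩ ⟨ c ,0⟩ ⟨0, d ⟩ = all-vanish (zeroˡ _) (zeroˡ _) (zeroˡ _)
  plücker ⟨ a ,0⟩ ⟨ b ,0⟩ ⟨0, c ⟩ ⟨ d ,0⟩ = all-vanish (zeroˡ _) (zeroʳ _) (zeroʳ _)
  plücker ⟨ a ,0⟩ ⟨ b ,0⟩ ⟨0, c ⟩ ⟨0, d ⟩ = left-vanishes (swap-first a c b d)
  plücker ⟨ a ,0⟩ ⟨0, b ⟩ ⟨ c ,0⟩ ⟨ d ,0⟩ = all-vanish (zeroʳ _) (zeroˡ _) (zeroʳ _)
  plücker ⟨ a ,0⟩ ⟨0, b ⟩ ⟨ c ,0⟩ ⟨0, d ⟩ = middle-vanishes (begin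
    (a * b) * (c * d)        ≈⟨ swap-first a b c d ⟩
    (c * b) * (a * d)        ≈⟨ -‿involutive _ ⟨
    - - ((c * b) * (a * d))  ≈⟨ -‿cong (-‿distribˡ-* (c * b) (a * d)) ⟩
    - (- (c * b) * (a * d))  ∎)
  plücker ⟨ a ,0⟩ ⟨0, b ⟩ ⟨0, c ⟩ ⟨ d ,0⟩ = right-vanishes (begin
    (a * b) * - (d * c)      ≈⟨ -‿distribʳ-* _ _ ⟨
    - ((a * b) * (d * c))    ≈⟨ -‿cong (swap-second a b d c) ⟩
    - ((a * c) * (d * b))    ≈⟨ -‿distribʳ-* _ _ ⟩
    (a * c) * - (d * b)      ∎)
  plücker ⟨ a ,0⟩ ⟨0, b ⟩ ⟨0, c ⟩ ⟨0, d ⟩ = all-vanish (zeroʳ _) (zeroʳ _) (zeroˡ _)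
  plücker ⟨0, a ⟩ ⟨ b ,0⟩ ⟨ c ,0⟩ ⟨ d ,0⟩ = all-vanish (zeroʳ _) (zeroʳ _) (zeroˡ _)
  plücker ⟨0, a ⟩ ⟨ b ,0⟩ ⟨ c ,0⟩ ⟨0, d ⟩ = right-vanishes (begin
    - (b * a) * (c * d)      ≈⟨ -‿distribˡ-* _ _ ⟨
    - ((b * a) * (c * d))    ≈⟨ -‿cong (swap-first b a c d) ⟩
    - ((c * a) * (b * d))    ≈⟨ -‿distribˡ-* _ _ ⟩
    - (c * a) * (b * d)      ∎)
  plücker ⟨0, a ⟩ ⟨ b ,0⟩ ⟨0, c ⟩ ⟨ d ,0⟩ = middle-vanishes (begin
    - (b * a) * - (d * c)    ≈⟨ -x*-y≈x*y _ _ ⟩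
    (b * a) * (d * c)        ≈⟨ swap-second b a d c ⟩
    (b * c) * (d * a)        ≈⟨ -‿involutive _ ⟨
    - - ((b * c) * (d * a))  ≈⟨ -‿cong (-‿distribʳ-* _ _) ⟩
    - ((b * c) * - (d * a))  ∎)
  plücker ⟨0, a ⟩ ⟨ b ,0⟩ ⟨0, c ⟩ ⟨0, d ⟩ = all-vanish (zeroʳ _) (zeroˡ _) (zeroʳ _)
  plücker ⟨0, a ⟩ ⟨0, b ⟩ ⟨ c ,0⟩ ⟨ d ,0⟩ = left-vanishes (begin
    - (c * a) * - (d * b)    ≈⟨ -x*-y≈x*y _ _ ⟩
    (c * a) * (d * b)        ≈⟨ swap-second c a d b ⟩
    (c * b) * (d * a)        ≈⟨ -x*-y≈x*y _ _ ⟨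
    - (c * b) * - (d * a)    ∎)
  plücker ⟨0, a ⟩ ⟨0, b ⟩ ⟨ c ,0⟩ ⟨0, d ⟩ = all-vanish (zeroˡ _) (zeroʳ _) (zeroʳ _)
  plücker ⟨0, a ⟩ ⟨0, b ⟩ ⟨0, c ⟩ ⟨ d ,0⟩ = all-vanish (zeroˡ _) (zeroˡ _) (zeroˡ _)
  plücker ⟨0, a ⟩ ⟨0, b ⟩ ⟨0, c ⟩ ⟨0, d ⟩ = all-vanish (zeroˡ _) (zeroˡ _) (zeroˡ _)

  module EllipticCriterion
    (N ρ t : ℤ) (N≡2t+1 : N ≡ t ℤ.* + 2 ℤ.+ 1ℤ) (N∤ρ : ¬ N ∣ ρ)
    (e g : ℤ → Carrier)
    (e-parallelogram : ∀ l j → e (l ℤ.+ j) * e (l ℤ.- j) ≈ e l * e l * g j)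
    (h : ℤ → Carrier)
    (h-plus : ∀ k → h (k ℤ.* N ℤ.+ ρ) ≈ e k)
    (h-minus : ∀ k → h (ℤ.- (k ℤ.* N ℤ.+ ρ)) ≈ - e k)
    (h-off : ∀ {m} → ¬ N ∣ m ℤ.- ρ → ¬ N ∣ m ℤ.+ ρ → h m ≈ 0#)
    where

    open Residues N ρ

    h-multiple : ∀ {m} → N ∣ m → h m ≈ 0#
    h-multiple {m} N∣m = h-off
      (λ N∣m-ρ → N∤ρ (subst (N ∣_) (ℤ.neg-involutive ρ) (∣m⇒∣-m (∣m+n∣m⇒∣n N∣m-ρ N∣m))))
      (λ N∣m+ρ → N∤ρ (∣m+n∣m⇒∣n N∣m+ρ N∣m))

    P : ℤ → ℤ → Carrier
    P x y = h (x ℤ.+ y) * h (x ℤ.- y)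

    P-off : ∀ {x y} → ¬ (Support₀ x × Support₀ y) → P x y ≈ 0#
    P-off {x} {y} off with support? (x ℤ.+ y) | support? (x ℤ.- y)
    ... | no ∉ | _        = ≈-trans (*-congʳ (h-off (∉ ∘ inj₁) (∉ ∘ inj₂))) (zeroˡ _)
    ... | yes _ | no ∉    = ≈-trans (*-congˡ (h-off (∉ ∘ inj₁) (∉ ∘ inj₂))) (zeroʳ _)
    ... | yes s₁ | yes s₂ = ⊥-elim (off (support-halves t N≡2t+1 s₁ s₂))

    private
      vanishesˡ : ∀ {u v} → h u ≈ 0# → h u * h v ≈ 0#
      vanishesˡ hu≈0 = ≈-trans (*-congʳ hu≈0) (zeroˡ _)

      vanishesʳ : ∀ {u v} → h v ≈ 0# → h u * h v ≈ 0#
      vanishesʳ hv≈0 = ≈-trans (*-congˡ hv≈0) (zeroʳ _)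

    P-plus-multiple : ∀ l j → P (l ℤ.* N ℤ.+ ρ) (j ℤ.* N) ≈ e l * e l * g j
    P-plus-multiple l j = begin
      h (l ℤ.* N ℤ.+ ρ ℤ.+ j ℤ.* N) * h (l ℤ.* N ℤ.+ ρ ℤ.- j ℤ.* N)
        ≡⟨ cong₂ (λ u v → h u * h v) sum diff ⟩
      h ((l ℤ.+ j) ℤ.* N ℤ.+ ρ) * h ((l ℤ.- j) ℤ.* N ℤ.+ ρ)
        ≈⟨ *-cong (h-plus (l ℤ.+ j)) (h-plus (l ℤ.- j)) ⟩
      e (l ℤ.+ j) * e (l ℤ.- j)      ≈⟨ e-parallelogram l j ⟩
      e l * e l * g j                ∎
      where
      sum : l ℤ.* N ℤ.+ ρ ℤ.+ j ℤ.* N ≡ (l ℤ.+ j) ℤ.* N ℤ.+ ρ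
      sum = solve (l ∷ j ∷ N ∷ ρ ∷ [])
      diff : l ℤ.* N ℤ.+ ρ ℤ.- j ℤ.* N ≡ (l ℤ.- j) ℤ.* N ℤ.+ ρ
      diff = solve (l ∷ j ∷ N ∷ ρ ∷ [])

    P-minus-multiple : ∀ l j → P (ℤ.- (l ℤ.* N ℤ.+ ρ)) (j ℤ.* N) ≈ e l * e l * g j
    P-minus-multiple l j = begin
      h (ℤ.- (l ℤ.* N ℤ.+ ρ) ℤ.+ j ℤ.* N) * h (ℤ.- (l ℤ.* N ℤ.+ ρ) ℤ.- j ℤ.* N)
        ≡⟨ cong₂ (λ u v → h u * h v) sum diff ⟩
      h (ℤ.- ((l ℤ.- j) ℤ.* N ℤ.+ ρ)) * h (ℤ.- ((l ℤ.+ j) ℤ.* N ℤ.+ ρ))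
        ≈⟨ *-cong (h-minus (l ℤ.- j)) (h-minus (l ℤ.+ j)) ⟩
      - e (l ℤ.- j) * - e (l ℤ.+ j)  ≈⟨ -x*-y≈x*y _ _ ⟩
      e (l ℤ.- j) * e (l ℤ.+ j)      ≈⟨ *-comm _ _ ⟩
      e (l ℤ.+ j) * e (l ℤ.- j)      ≈⟨ e-parallelogram l j ⟩
      e l * e l * g j                ∎
      where
      sum : ℤ.- (l ℤ.* N ℤ.+ ρ) ℤ.+ j ℤ.* N ≡ ℤ.- ((l ℤ.- j) ℤ.* N ℤ.+ ρ)
      sum = solve (l ∷ j ∷ N ∷ ρ ∷ [])
      diff : ℤ.- (l ℤ.* N ℤ.+ ρ) ℤ.- j ℤ.* N ≡ ℤ.- ((l ℤ.+ j) ℤ.* N ℤ.+ ρ)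
      diff = solve (l ∷ j ∷ N ∷ ρ ∷ [])

    P-multiple-plus : ∀ j l → P (j ℤ.* N) (l ℤ.* N ℤ.+ ρ) ≈ - (e l * e l * g j)
    P-multiple-plus j l = begin
      h (j ℤ.* N ℤ.+ (l ℤ.* N ℤ.+ ρ)) * h (j ℤ.* N ℤ.- (l ℤ.* N ℤ.+ ρ))
        ≡⟨ cong₂ (λ u v → h u * h v) sum diff ⟩
      h ((l ℤ.+ j) ℤ.* N ℤ.+ ρ) * h (ℤ.- ((l ℤ.- j) ℤ.* N ℤ.+ ρ))
        ≈⟨ *-cong (h-plus (l ℤ.+ j)) (h-minus (l ℤ.- j)) ⟩
      e (l ℤ.+ j) * - e (l ℤ.- j)     ≈⟨ -‿distribʳ-* _ _ ⟨
      - (e (l ℤ.+ j) * e (l ℤ.- j))   ≈⟨ -‿cong (e-parallelogram l j) ⟩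
      - (e l * e l * g j)             ∎
      where
      sum : j ℤ.* N ℤ.+ (l ℤ.* N ℤ.+ ρ) ≡ (l ℤ.+ j) ℤ.* N ℤ.+ ρ
      sum = solve (l ∷ j ∷ N ∷ ρ ∷ [])
      diff : j ℤ.* N ℤ.- (l ℤ.* N ℤ.+ ρ) ≡ ℤ.- ((l ℤ.- j) ℤ.* N ℤ.+ ρ)
      diff = solve (l ∷ j ∷ N ∷ ρ ∷ [])

    P-multiple-minus : ∀ j l → P (j ℤ.* N) (ℤ.- (l ℤ.* N ℤ.+ ρ)) ≈ - (e l * e l * g j)
    P-multiple-minus j l = begin
      h (j ℤ.* N ℤ.+ ℤ.- (l ℤ.* N ℤ.+ ρ)) * h (j ℤ.* N ℤ.- ℤ.- (l ℤ.* N ℤ.+ ρ))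
        ≡⟨ cong₂ (λ u v → h u * h v) sum diff ⟩
      h (ℤ.- ((l ℤ.- j) ℤ.* N ℤ.+ ρ)) * h ((l ℤ.+ j) ℤ.* N ℤ.+ ρ)
        ≈⟨ *-cong (h-minus (l ℤ.- j)) (h-plus (l ℤ.+ j)) ⟩
      - e (l ℤ.- j) * e (l ℤ.+ j)     ≈⟨ -‿distribˡ-* _ _ ⟨
      - (e (l ℤ.- j) * e (l ℤ.+ j))   ≈⟨ -‿cong (*-comm _ _) ⟩
      - (e (l ℤ.+ j) * e (l ℤ.- j))   ≈⟨ -‿cong (e-parallelogram l j) ⟩
      - (e l * e l * g j)             ∎
      where
      sum : j ℤ.* N ℤ.+ ℤ.- (l ℤ.* N ℤ.+ ρ) ≡ ℤ.- ((l ℤ.- j) ℤ.* N ℤ.+ ρ)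
      sum = solve (l ∷ j ∷ N ∷ ρ ∷ [])
      diff : j ℤ.* N ℤ.- ℤ.- (l ℤ.* N ℤ.+ ρ) ≡ (l ℤ.+ j) ℤ.* N ℤ.+ ρ
      diff = solve (l ∷ j ∷ N ∷ ρ ∷ [])

    vector : ∀ {x} → Residue x → AxisVector
    vector (multiple j _) = ⟨0, g j ⟩
    vector (plus l _)     = ⟨ e l * e l ,0⟩
    vector (minus l _)    = ⟨ e l * e l ,0⟩
    vector (other _)      = ⟨ 0# ,0⟩

    P-det : ∀ {x y} (rx : Residue x) (ry : Residue y) → P x y ≈ det (vector rx) (vector ry)
    P-det (other x∉) ry     = ≈-trans (P-off (x∉ ∘ proj₁)) (≈-sym (det-zeroˡ (vector ry)))
    P-det {x} rx (other y∉) = ≈-trans (P-off {x} (y∉ ∘ proj₂)) (≈-sym (det-zeroʳ (vector rx)))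
    P-det (multiple j refl) (multiple k refl) =
      vanishesˡ (h-multiple (∣m∣n⇒∣m+n (∣n⇒∣m*n j ∣-refl) (∣n⇒∣m*n k ∣-refl)))
    P-det (multiple j refl) (plus l refl)  = P-multiple-plus j l
    P-det (multiple j refl) (minus l refl) = P-multiple-minus j l
    P-det (plus l refl) (multiple j refl)  = P-plus-multiple l j
    P-det (plus l refl) (plus k refl)      = vanishesʳ (h-multiple (∣plus-plus l k))
    P-det (plus l refl) (minus k refl)     = vanishesˡ (h-multiple (∣plus+minus l k))
    P-det (minus l refl) (multiple j refl) = P-minus-multiple l j
    P-det (minus l refl) (plus k refl)     = vanishesˡ (h-multiple (∣minus+plus l k))
    P-det (minus l refl) (minus k refl)    = vanishesʳ (h-multiple (∣minus-minus l k))

    vec : ℤ → AxisVector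
    vec x = vector (residue x)

    P*P≈det*det : ∀ x y z w → h (x ℤ.+ y) * h (x ℤ.- y) * h (z ℤ.+ w) * h (z ℤ.- w)
                              ≈ det (vec x) (vec y) * det (vec z) (vec w)
    P*P≈det*det x y z w =
      ≈-trans (*-assoc _ _ _) (*-cong (P-det (residue x) (residue y)) (P-det (residue z) (residue w)))

    elliptic : ∀ a b c d →
      h (a ℤ.+ b) * h (a ℤ.- b) * h (c ℤ.+ d) * h (c ℤ.- d)
        ≈ h (a ℤ.+ c) * h (a ℤ.- c) * h (b ℤ.+ d) * h (b ℤ.- d)
          - h (b ℤ.+ c) * h (b ℤ.- c) * h (a ℤ.+ d) * h (a ℤ.- d)
    elliptic a b c d = begin
      h (a ℤ.+ b) * h (a ℤ.- b) * h (c ℤ.+ d) * h (c ℤ.- d)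
        ≈⟨ P*P≈det*det a b c d ⟩
      det (vec a) (vec b) * det (vec c) (vec d)
        ≈⟨ plücker (vec a) (vec b) (vec c) (vec d) ⟩
      det (vec a) (vec c) * det (vec b) (vec d) - det (vec b) (vec c) * det (vec a) (vec d)
        ≈⟨ +-cong (P*P≈det*det a c b d) (-‿cong (P*P≈det*det b c a d)) ⟨
      h (a ℤ.+ c) * h (a ℤ.- c) * h (b ℤ.+ d) * h (b ℤ.- d)
        - h (b ℤ.+ c) * h (b ℤ.- c) * h (a ℤ.+ d) * h (a ℤ.- d) ∎

  module SequenceES
    (A B D : Carrier) (r s t : ℕ)
    (0<r : 0 < r) (r<s : r < s) (r+s≡1+2t : r ℕ.+ s ≡ suc (t ℕ.* 2))
    where

    open CommutativeSemiringExp commutativeSemiring using (_^_; ^-homo-*; ^-distrib-*)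
    open CommutativeMonoidSolver *-commutativeMonoid using (_⊕_; _⊜_) renaming (solve to cm-solve)

    n : ℕ
    n = suc (t ℕ.* 2)

    N : ℤ
    N = + n

    h : ℤ → Carrier
    h = ES R r s A B D

    e : ℤ → Carrier
    e k = A * B ^ tri⁻ k * D ^ tri k

    g : ℤ → Carrier
    g j = (B * D) ^ (ℤ.∣ j ∣ ℕ.* ℤ.∣ j ∣)

    r<n : r < n
    r<n = ℕ.<-≤-trans (ℕ.m<m+n r (ℕ.<-≤-trans 0<r (ℕ.<⇒≤ r<s))) (ℕ.≤-reflexive r+s≡1+2t)

    s<n : s < n
    s<n = ℕ.<-≤-trans (ℕ.m<n+m s 0<r) (ℕ.≤-reflexive r+s≡1+2t)

    N≡r+s : N ≡ + r ℤ.+ + s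
    N≡r+s = cong +_ (sym r+s≡1+2t)

    N≡2t+1 : N ≡ + t ℤ.* + 2 ℤ.+ 1ℤ
    N≡2t+1 = trans (cong (ℤ._+_ 1ℤ) (ℤ.pos-* t 2)) (ℤ.+-comm 1ℤ (+ t ℤ.* + 2))

    N∤r : ¬ N ∣ + r
    N∤r N∣r = ℕ.<⇒≱ r<n (ℕ.∣⇒≤ {{ℕ.>-nonZero 0<r}} (∣⇒∣ᵤ N∣r))

    ES-unfold : ∀ m → h m ≡ ES-aux R r s n A B D m
    ES-unfold m = unfold r+s≡1+2t
      where
      unfold : ∀ {k} → r ℕ.+ s ≡ suc k → ES R r s A B D m ≡ ES-aux R r s (suc k) A B D m
      unfold eq with r ℕ.+ s
      unfold refl | _ = refl

    h-at-r : ∀ {m} → m %ℕ n ≡ r → h m ≡ e (m /ℕ n)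
    h-at-r {m} m%n≡r rewrite ES-unfold m with m %ℕ n ℕ.≟ r | m %ℕ n ℕ.≟ s
    ... | yes _    | _ = refl
    ... | no m%n≢r | _ = ⊥-elim (m%n≢r m%n≡r)

    h-at-s : ∀ {m} → m %ℕ n ≡ s → h m ≡ - (A * B ^ tri (m /ℕ n ℤ.+ 1ℤ) * D ^ tri⁻ (m /ℕ n ℤ.+ 1ℤ))
    h-at-s {m} m%n≡s rewrite ES-unfold m with m %ℕ n ℕ.≟ r | m %ℕ n ℕ.≟ s
    ... | yes m%n≡r | _        = ⊥-elim (ℕ.<-irrefl (trans (sym m%n≡r) m%n≡s) r<s)
    ... | no _      | yes _    = refl
    ... | no _      | no m%n≢s = ⊥-elim (m%n≢s m%n≡s)

    h-elsewhere : ∀ {m} → m %ℕ n ≢ r → m %ℕ n ≢ s → h m ≡ 0#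
    h-elsewhere {m} m%n≢r m%n≢s rewrite ES-unfold m with m %ℕ n ℕ.≟ r | m %ℕ n ℕ.≟ s
    ... | yes m%n≡r | _         = ⊥-elim (m%n≢r m%n≡r)
    ... | no _      | yes m%n≡s = ⊥-elim (m%n≢s m%n≡s)
    ... | no _      | no _      = refl

    h-plus : ∀ k → h (k ℤ.* N ℤ.+ + r) ≈ e k
    h-plus k =
      let m/n≡k , m%n≡r = divmod-unique k r<n
      in ≈-reflexive (trans (h-at-r m%n≡r) (cong e m/n≡k))

    h-minus : ∀ k → h (ℤ.- (k ℤ.* N ℤ.+ + r)) ≈ - e k
    h-minus k = begin
      h (ℤ.- (k ℤ.* N ℤ.+ + r))  ≡⟨ cong h minus-form ⟩
      h m                        ≡⟨ h-at-s m%n≡s ⟩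
      ē (m /ℕ n ℤ.+ 1ℤ)          ≡⟨ cong ē (trans (cong (ℤ._+ 1ℤ) m/n≡q) q+1≡-k) ⟩
      ē (ℤ.- k)                  ≡⟨ cong₂ (λ b d → - (A * B ^ b * D ^ d)) (tri-neg k) (tri⁻-neg k) ⟩
      - e k                      ∎
      where
      q = ℤ.- k ℤ.- 1ℤ
      m = q ℤ.* N ℤ.+ + s
      ē : ℤ → Carrier
      ē u = - (A * B ^ tri u * D ^ tri⁻ u)
      q+1≡-k : ℤ.- k ℤ.- 1ℤ ℤ.+ 1ℤ ≡ ℤ.- k
      q+1≡-k = solve (k ∷ [])
      m/n≡q = proj₁ (divmod-unique q s<n)
      m%n≡s = proj₂ (divmod-unique q s<n)
      shift : ∀ k a b → ℤ.- (k ℤ.* (a ℤ.+ b) ℤ.+ a) ≡ (ℤ.- k ℤ.- 1ℤ) ℤ.* (a ℤ.+ b) ℤ.+ b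
      shift = solve-∀
      minus-form : ℤ.- (k ℤ.* N ℤ.+ + r) ≡ m
      minus-form = subst (λ M → ℤ.- (k ℤ.* M ℤ.+ + r) ≡ q ℤ.* M ℤ.+ + s) (sym N≡r+s) (shift k (+ r) (+ s))

    N∣m-[m%n] : ∀ m → N ∣ m ℤ.- + (m %ℕ n)
    N∣m-[m%n] m = divides (m /ℕ n)
      (trans (cong (ℤ._- + (m %ℕ n)) (a≡a%ℕn+[a/ℕn]*n m n)) (cancel (+ (m %ℕ n)) _))
      where
      cancel : ∀ a b → a ℤ.+ b ℤ.- a ≡ b
      cancel = solve-∀

    h-off : ∀ {m} → ¬ N ∣ m ℤ.- + r → ¬ N ∣ m ℤ.+ + r → h m ≈ 0#
    h-off {m} N∤m-r N∤m+r = ≈-reflexive (h-elsewhere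
      (λ m%n≡r → N∤m-r (subst (λ a → N ∣ m ℤ.- + a) m%n≡r (N∣m-[m%n] m)))
      (λ m%n≡s → N∤m+r (subst (N ∣_) shift
        (∣m∣n⇒∣m+n (subst (λ a → N ∣ m ℤ.- + a) m%n≡s (N∣m-[m%n] m)) ∣-refl))))
      where
      add-N : ∀ m a b → m ℤ.- b ℤ.+ (a ℤ.+ b) ≡ m ℤ.+ a
      add-N = solve-∀
      shift : m ℤ.- + s ℤ.+ N ≡ m ℤ.+ + r
      shift = subst (λ M → m ℤ.- + s ℤ.+ M ≡ m ℤ.+ + r) (sym N≡r+s) (add-N m (+ r) (+ s))

    e-parallelogram : ∀ l j → e (l ℤ.+ j) * e (l ℤ.- j) ≈ e l * e l * g j
    e-parallelogram l j = begin
      (A * B ^ tri⁻ (l ℤ.+ j) * D ^ tri (l ℤ.+ j)) * (A * B ^ tri⁻ (l ℤ.- j) * D ^ tri (l ℤ.- j))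
        ≈⟨ regroup A (B ^ tri⁻ (l ℤ.+ j)) (D ^ tri (l ℤ.+ j)) (B ^ tri⁻ (l ℤ.- j)) (D ^ tri (l ℤ.- j)) ⟩
      A * A * (B ^ tri⁻ (l ℤ.+ j) * B ^ tri⁻ (l ℤ.- j)) * (D ^ tri (l ℤ.+ j) * D ^ tri (l ℤ.- j))
        ≈⟨ *-cong (*-congˡ (^-homo-* B (tri⁻ (l ℤ.+ j)) (tri⁻ (l ℤ.- j))))
                  (^-homo-* D (tri (l ℤ.+ j)) (tri (l ℤ.- j))) ⟨
      A * A * B ^ (tri⁻ (l ℤ.+ j) ℕ.+ tri⁻ (l ℤ.- j)) * D ^ (tri (l ℤ.+ j) ℕ.+ tri (l ℤ.- j))
        ≡⟨ cong₂ (λ b d → A * A * B ^ b * D ^ d) (tri⁻-parallelogram l j) (tri-parallelogram l j) ⟩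
      A * A * B ^ (j² ℕ.+ (tri⁻ l ℕ.+ tri⁻ l)) * D ^ (j² ℕ.+ (tri l ℕ.+ tri l))
        ≈⟨ *-cong (*-congˡ (^-split B j² (tri⁻ l))) (^-split D j² (tri l)) ⟩
      A * A * (B ^ j² * (B ^ tri⁻ l * B ^ tri⁻ l)) * (D ^ j² * (D ^ tri l * D ^ tri l))
        ≈⟨ regroup′ A (B ^ j²) (B ^ tri⁻ l) (D ^ j²) (D ^ tri l) ⟩
      e l * e l * (B ^ j² * D ^ j²)
        ≈⟨ *-congˡ (^-distrib-* B D j²) ⟨
      e l * e l * g j ∎
      where
      j² = ℤ.∣ j ∣ ℕ.* ℤ.∣ j ∣

      ^-split : ∀ x a b → x ^ (a ℕ.+ (b ℕ.+ b)) ≈ x ^ a * (x ^ b * x ^ b)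
      ^-split x a b = ≈-trans (^-homo-* x a (b ℕ.+ b)) (*-congˡ (^-homo-* x b b))

      regroup : ∀ a b₁ d₁ b₂ d₂ → (a * b₁ * d₁) * (a * b₂ * d₂) ≈ a * a * (b₁ * b₂) * (d₁ * d₂)
      regroup = cm-solve 5 (λ a b₁ d₁ b₂ d₂ →
        ((a ⊕ b₁) ⊕ d₁) ⊕ ((a ⊕ b₂) ⊕ d₂) ⊜ ((a ⊕ a) ⊕ (b₁ ⊕ b₂)) ⊕ (d₁ ⊕ d₂)) ≈-refl

      regroup′ : ∀ a b b′ d d′ → a * a * (b * (b′ * b′)) * (d * (d′ * d′))
                                 ≈ (a * b′ * d′) * (a * b′ * d′) * (b * d)
      regroup′ = cm-solve 5 (λ a b b′ d d′ →
        ((a ⊕ a) ⊕ (b ⊕ (b′ ⊕ b′))) ⊕ (d ⊕ (d′ ⊕ d′))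
          ⊜ (((a ⊕ b′) ⊕ d′) ⊕ ((a ⊕ b′) ⊕ d′)) ⊕ (b ⊕ d)) ≈-refl

    open EllipticCriterion N (+ r) (+ t) N≡2t+1 N∤r e g e-parallelogram h h-plus h-minus h-off
      public using (elliptic)

theorem6p1 : ∀ {c ℓ : Level} (R : CommutativeRing c ℓ) (r s : ℕ)
    → 0 < r → r < s → r % 2 ≢ s % 2
    → (A B D : CommutativeRing.Carrier R)
    → let open CommutativeRing R
          h = ES R r s A B D
      in (a b c d : ℤ)
    → h (a ℤ.+ b) * h (a ℤ.- b) * h (c ℤ.+ d) * h (c ℤ.- d)
      ≈ h (a ℤ.+ c) * h (a ℤ.- c) * h (b ℤ.+ d) * h (b ℤ.- d)
        - h (b ℤ.+ c) * h (b ℤ.- c) * h (a ℤ.+ d) * h (a ℤ.- d)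
theorem6p1 R r s 0<r r<s r≢s[mod2] A B D =
  SequenceES.elliptic R A B D r s ((r ℕ.+ s) ℕ./ 2) 0<r r<s (odd-sum r s r≢s[mod2])
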